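{- For every integer $n\ge 1$, $$\sum_{k=0}^{\infty}b_7^+\bigl(n-2k(3k-1)\bigr)+\sum_{k=1}^{\infty}b_7^+\bigl(n-2k(3k+1)\bigr)\equiv\begin{cases}1\pmod 2 & \text{if } n=14l(3l-1)+1\text{ or } n=14l(3l+1)+1\text{ for some integer } l\ge 0,\\ 0\pmod 2 & \text{otherwise.}\end{cases}$$ (The sums are finite since only finitely many arguments are $\ge 1$.)
   Context: Let $q=e^{2\pi i z}$ with $z$ in the upper half-plane, and $\eta(z)=q^{1/24}\prod_{n\ge1}(1-q^n)$. Define the integers $b_7^+(n)$ by $\left(\frac{\eta(7z)}{\eta(z)}\right)^{4}=\sum_{n\ge 1}b_7^+(n)q^n$, with $b_7^+(n)=0$ for $n<1$. -}

module Defs where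

open import Data.Nat as ℕ using (ℕ; zero; suc)
open import Data.Nat.Divisibility using (_∣?_)
open import Data.Integer as ℤ using (ℤ; +_; -[1+_]; _+_; _*_; -_; 0ℤ; 1ℤ)
open import Relation.Nullary.Decidable using (does)
open import Data.Bool using (if_then_else_)

-- Formal power series with integer coefficients: ℕ → ℤ (coefficient of q^N).
Series : Set
Series = ℕ → ℤ

Σ≤ : ℕ → (ℕ → ℤ) → ℤ
Σ≤ zero    f = f zero
Σ≤ (suc n) f = Σ≤ n f + f (suc n)

_⊛_ : Series → Series → Series
(f ⊛ g) N = Σ≤ N (λ i → f i * g (N ℕ.∸ i))

-- 1 - q^k   (for k ≥ 1 we use it with k = suc _)
oneMinusQ^ : ℕ → Series
oneMinusQ^ k zero = 1ℤ
oneMinusQ^ k (suc N) = if does (suc N ℕ.≟ k) then - 1ℤ else 0ℤ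

-- 1/(1 - q^k) = Σ_j q^{k j}, for k ≥ 1 (here k = suc m)
geom : ℕ → Series
geom m N = if does (suc m ∣? N) then 1ℤ else 0ℤ

pow4 : Series → Series
pow4 f = f ⊛ (f ⊛ (f ⊛ f))

-- the m-th factor (1 - q^{7m})^4 / (1 - q^m)^4, for m = suc j
factor : ℕ → Series
factor j = pow4 (oneMinusQ^ (7 ℕ.* suc j)) ⊛ pow4 (geom j)

one : Series
one zero = 1ℤ
one (suc _) = 0ℤ

partialProd : ℕ → Series
partialProd zero = one
partialProd (suc M) = partialProd M ⊛ factor M

-- Coefficient of q^N in the infinite product ∏_{m≥1} (1-q^{7m})^4/(1-q^m)^4;
-- factors with m > N do not affect this coefficient.
prodCoeff : ℕ → ℤ
prodCoeff N = partialProd N N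

-- (η(7z)/η(z))^4 = q · ∏_{m≥1} (1-q^{7m})^4/(1-q^m)^4   (since 4·(7-1)/24 = 1),
-- so b₇⁺(n) = prodCoeff (n-1) for n ≥ 1, and b₇⁺(n) = 0 for n < 1.
b7⁺ : ℤ → ℤ
b7⁺ (+ zero)    = 0ℤ
b7⁺ (+ suc N)   = prodCoeff N
b7⁺ -[1+ _ ]    = 0ℤ

open import Data.Product using (∃-syntax)
open import Data.Sum using (_⊎_)
open import Relation.Binary.PropositionalEquality using (_≡_)
open import Data.Integer using (_-_)

SpecialForm : ℕ → Set
SpecialForm n = ∃[ l ] ((+ n ≡ + 14 * + l * (+ 3 * + l - 1ℤ) + 1ℤ)
                      ⊎ (+ n ≡ + 14 * + l * (+ 3 * + l + 1ℤ) + 1ℤ))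

-- The left-hand side; the sums are truncated at k = n, since for k > n
-- all arguments are < 1 and the terms vanish (b₇⁺ is 0 there anyway).
lhs : ℕ → ℤ
lhs n = Σ≤ n (λ k → b7⁺ (+ n - + 2 * + k * (+ 3 * + k - 1ℤ)))
      + Σ≤ n (λ k → b7⁺ (+ n - + 2 * + suc k * (+ 3 * + suc k + 1ℤ)))

module Submission where

-- Write B = Σ b₇⁺(N) q^N = q ∏ (1-q^{7m})^4/(1-q^m)^4 and 2k(3k ∓ 1) = 4·pent∓(k).
-- By Euler's pentagonal number theorem for q^4, the left-hand side is, modulo 2, the coefficient
-- of q^n in (q^4; q^4)_∞ · B.  Modulo 2 (Frobenius) (1 - q^{7m})^4 ≡ 1 - q^{28m} and
-- (1 - q^m)^4 ≡ 1 - q^{4m}, so (q^4; q^4)_∞ · B ≡ q (q^28; q^28)_∞, whose coefficient of q^n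
-- is odd exactly when n - 1 = 28·pent∓(l), again by the pentagonal number theorem.
--
-- Everything is finitary: the pentagonal number theorem is used in Shanks' finite form
-- S_n + 1 = Σ_{k ≤ n} (-1)^k (q^{d·pent⁻ k} + q^{d·pent⁺ k}), where S_n agrees with
-- (q^d; q^d)_n below degree n + 1, and infinite products are replaced by partial products,
-- which stabilise coefficientwise.

open import Defs
open import Data.Nat as ℕ using (ℕ; zero; suc; _≤_; _<_; z≤n; s≤s; _∸_; _≥_)
import Data.Nat.Properties as ℕP
open import Data.Nat.Divisibility using (_∣_; _∣?_; ∣⇒≤; ∣m+n∣m⇒∣n; ∣m∸n∣n⇒∣m; ∣-refl; _∣0)
open import Data.Nat.Tactic.RingSolver as ℕSolver using ()
open import Data.Integer as ℤ using (ℤ; +_; -[1+_]; _+_; _*_; -_; 0ℤ; 1ℤ; _-_; _%ℕ_)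
import Data.Integer.Properties as ℤP
open import Data.Integer.DivMod using (a≡a%ℕn+[a/ℕn]*n; n%ℕd<d)
open import Data.Integer.Tactic.RingSolver using (solve-∀)
open import Relation.Binary.PropositionalEquality
open import Data.Product using (∃-syntax; _×_; _,_)
open import Data.Sum using (_⊎_; inj₁; inj₂)
open import Data.Bool using (true; false; if_then_else_)
open import Relation.Nullary using (¬_; Dec; yes; no; does)
open import Relation.Nullary.Negation using (contradiction)
open import Function using (_∘_)
import Relation.Binary.Reasoning.Setoid as SetoidReasoning
open import Relation.Binary.Bundles using (Setoid)
open import Relation.Binary.Definitions using (tri<; tri≈; tri>)

Σ-cong : ∀ N {f g : ℕ → ℤ} → (∀ i → i ≤ N → f i ≡ g i) → Σ≤ N f ≡ Σ≤ N g
Σ-cong zero    h = h 0 z≤n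
Σ-cong (suc N) h = cong₂ _+_ (Σ-cong N (λ i i≤N → h i (ℕP.m≤n⇒m≤1+n i≤N))) (h (suc N) ℕP.≤-refl)

Σ-zero : ∀ N {f : ℕ → ℤ} → (∀ i → i ≤ N → f i ≡ 0ℤ) → Σ≤ N f ≡ 0ℤ
Σ-zero zero    h = h 0 z≤n
Σ-zero (suc N) h = cong₂ _+_ (Σ-zero N (λ i i≤N → h i (ℕP.m≤n⇒m≤1+n i≤N))) (h (suc N) ℕP.≤-refl)

Σ-+ : ∀ N (f g : ℕ → ℤ) → Σ≤ N (λ i → f i + g i) ≡ Σ≤ N f + Σ≤ N g
Σ-+ zero    f g = refl
Σ-+ (suc N) f g = trans (cong (_+ (f (suc N) + g (suc N))) (Σ-+ N f g))
                        (interchange (Σ≤ N f) (Σ≤ N g) (f (suc N)) (g (suc N)))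
  where interchange : ∀ a b c d → a + b + (c + d) ≡ a + c + (b + d)
        interchange = solve-∀

Σ-neg : ∀ N (f : ℕ → ℤ) → Σ≤ N (λ i → - f i) ≡ - Σ≤ N f
Σ-neg zero    f = refl
Σ-neg (suc N) f = trans (cong (_+ - f (suc N)) (Σ-neg N f)) (sym (ℤP.neg-distrib-+ (Σ≤ N f) (f (suc N))))

Σ-*ˡ : ∀ N c (f : ℕ → ℤ) → Σ≤ N (λ i → c * f i) ≡ c * Σ≤ N f
Σ-*ˡ zero    c f = refl
Σ-*ˡ (suc N) c f = trans (cong (_+ c * f (suc N)) (Σ-*ˡ N c f)) (sym (ℤP.*-distribˡ-+ c (Σ≤ N f) (f (suc N))))

Σ-*ʳ : ∀ N c (f : ℕ → ℤ) → Σ≤ N (λ i → f i * c) ≡ Σ≤ N f * c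
Σ-*ʳ N c f = trans (Σ-cong N (λ i _ → ℤP.*-comm (f i) c)) (trans (Σ-*ˡ N c f) (ℤP.*-comm c _))

Σ-first-only : ∀ N (f : ℕ → ℤ) → (∀ i → f (suc i) ≡ 0ℤ) → Σ≤ N f ≡ f 0
Σ-first-only zero    f _ = refl
Σ-first-only (suc N) f h = trans (cong₂ _+_ (Σ-first-only N f h) (h N)) (ℤP.+-identityʳ (f 0))

Σ-first : ∀ N (f : ℕ → ℤ) → Σ≤ (suc N) f ≡ f 0 + Σ≤ N (f ∘ suc)
Σ-first zero    f = refl
Σ-first (suc N) f = trans (cong (_+ f (suc (suc N))) (Σ-first N f)) (ℤP.+-assoc (f 0) _ _)

Σ-reverse : ∀ N (f : ℕ → ℤ) → Σ≤ N f ≡ Σ≤ N (λ i → f (N ∸ i))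
Σ-reverse zero    f = refl
Σ-reverse (suc N) f = begin
    Σ≤ N f + f (suc N)                        ≡⟨ cong (_+ f (suc N)) (Σ-reverse N f) ⟩
    Σ≤ N (λ i → f (N ∸ i)) + f (suc N)        ≡⟨ ℤP.+-comm _ (f (suc N)) ⟩
    f (suc N) + Σ≤ N (λ i → f (suc N ∸ suc i)) ≡⟨ Σ-first N (λ i → f (suc N ∸ i)) ⟨
    Σ≤ (suc N) (λ i → f (suc N ∸ i))          ∎
  where open ≡-Reasoning

Σ-swap : ∀ a b (G : ℕ → ℕ → ℤ) → Σ≤ a (λ i → Σ≤ b (G i)) ≡ Σ≤ b (λ k → Σ≤ a (λ i → G i k))
Σ-swap zero    b G = refl
Σ-swap (suc a) b G = trans (cong (_+ Σ≤ b (G (suc a))) (Σ-swap a b G))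
                           (sym (Σ-+ b (λ k → Σ≤ a (λ i → G i k)) (G (suc a))))

Σ-triangle : ∀ N (F : ℕ → ℕ → ℤ) →
  Σ≤ N (λ a → Σ≤ a (λ i → F i a)) ≡ Σ≤ N (λ i → Σ≤ (N ∸ i) (λ j → F i (i ℕ.+ j)))
Σ-triangle zero    F = refl
Σ-triangle (suc N) F = begin
    Σ≤ N (λ a → Σ≤ a (λ i → F i a)) + (Σ≤ N (λ i → F i (suc N)) + F (suc N) (suc N))
  ≡⟨ cong (_+ (Σ≤ N (λ i → F i (suc N)) + F (suc N) (suc N))) (Σ-triangle N F) ⟩
    Inner N + (Σ≤ N (λ i → F i (suc N)) + F (suc N) (suc N))
  ≡⟨ ℤP.+-assoc (Inner N) _ _ ⟨
    Inner N + Σ≤ N (λ i → F i (suc N)) + F (suc N) (suc N)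
  ≡⟨ cong₂ _+_ (sym (Σ-+ N _ _)) (cong (F (suc N)) (sym (ℕP.+-identityʳ (suc N)))) ⟩
    Σ≤ N (λ i → Σ≤ (N ∸ i) (λ j → F i (i ℕ.+ j)) + F i (suc N)) + F (suc N) (suc N ℕ.+ 0)
  ≡⟨ cong₂ _+_ (Σ-cong N extend) (cong (λ m → Σ≤ m (λ j → F (suc N) (suc N ℕ.+ j))) (sym (ℕP.n∸n≡0 (suc N)))) ⟩
    Inner (suc N) ∎
  where
  open ≡-Reasoning
  Inner : ℕ → ℤ
  Inner M = Σ≤ M (λ i → Σ≤ (M ∸ i) (λ j → F i (i ℕ.+ j)))
  extend : ∀ i → i ≤ N → Σ≤ (N ∸ i) (λ j → F i (i ℕ.+ j)) + F i (suc N)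
                        ≡ Σ≤ (suc N ∸ i) (λ j → F i (i ℕ.+ j))
  extend i i≤N rewrite ℕP.+-∸-assoc 1 i≤N =
    cong (λ m → Σ≤ (N ∸ i) (λ j → F i (i ℕ.+ j)) + F i m)
         (trans (cong suc (sym (ℕP.m+[n∸m]≡n i≤N))) (sym (ℕP.+-suc i (N ∸ i))))

Σ-telescope : ∀ m (f : ℕ → ℤ) → Σ≤ m (λ k → f k - f (suc k)) ≡ f 0 - f (suc m)
Σ-telescope zero    f = refl
Σ-telescope (suc m) f = trans (cong (_+ (f (suc m) - f (suc (suc m)))) (Σ-telescope m f))
                              (cancel (f 0) (f (suc m)) (f (suc (suc m))))
  where cancel : ∀ a b c → a - b + (b - c) ≡ a - c
        cancel = solve-∀

infix 4 _≡₂_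
infix 1 _by_
record _≡₂_ (a b : ℤ) : Set where
  constructor _by_
  field
    half : ℤ
    eq   : a ≡ b + (half + half)

≡⇒≡₂ : ∀ {a b} → a ≡ b → a ≡₂ b
≡⇒≡₂ {a} refl = 0ℤ by sym (ℤP.+-identityʳ a)

≡₂-refl : ∀ {a} → a ≡₂ a
≡₂-refl = ≡⇒≡₂ refl

≡₂-sym : ∀ {a b} → a ≡₂ b → b ≡₂ a
≡₂-sym {a} {b} (k by refl) = - k by flip b k
  where flip : ∀ b k → b ≡ b + (k + k) + (- k + - k)
        flip = solve-∀

≡₂-trans : ∀ {a b c} → a ≡₂ b → b ≡₂ c → a ≡₂ c
≡₂-trans {c = c} (k by refl) (l by refl) = l + k by combine c k l
  where combine : ∀ c k l → c + (l + l) + (k + k) ≡ c + (l + k + (l + k))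
        combine = solve-∀

≡₂-+ : ∀ {a b a' b'} → a ≡₂ b → a' ≡₂ b' → a + a' ≡₂ b + b'
≡₂-+ {b = b} {b' = b'} (k by refl) (l by refl) = k + l by combine b b' k l
  where combine : ∀ b b' k l → b + (k + k) + (b' + (l + l)) ≡ b + b' + (k + l + (k + l))
        combine = solve-∀

≡₂-* : ∀ {a b a' b'} → a ≡₂ b → a' ≡₂ b' → a * a' ≡₂ b * b'
≡₂-* {b = b} {b' = b'} (k by refl) (l by refl) = k * b' + b * l + (k * l + k * l) by expand b b' k l
  where expand : ∀ b b' k l → (b + (k + k)) * (b' + (l + l))
                            ≡ b * b' + ((k * b' + b * l + (k * l + k * l)) + (k * b' + b * l + (k * l + k * l)))
        expand = solve-∀

≡₂-neg : ∀ a → - a ≡₂ a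
≡₂-neg a = - a by negate a
  where negate : ∀ a → - a ≡ a + (- a + - a)
        negate = solve-∀

≡₂-cancelʳ : ∀ {a b} x → a + x ≡₂ b + x → a ≡₂ b
≡₂-cancelʳ {a} {b} x (k by e) = k by (begin
    a                    ≡⟨ addSub a x ⟩
    a + x - x            ≡⟨ cong (_- x) e ⟩
    b + x + (k + k) - x  ≡⟨ subAdd b x k ⟩
    b + (k + k)          ∎)
  where open ≡-Reasoning
        addSub : ∀ a x → a ≡ a + x - x
        addSub = solve-∀
        subAdd : ∀ b x k → b + x + (k + k) - x ≡ b + (k + k)
        subAdd = solve-∀

≡₂-setoid : Setoid _ _
≡₂-setoid = record
  { Carrier       = ℤ
  ; _≈_           = _≡₂_
  ; isEquivalence = record { refl = ≡₂-refl ; sym = ≡₂-sym ; trans = ≡₂-trans }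
  }

module ≡₂-Reasoning = SetoidReasoning ≡₂-setoid

Σ-cong₂ : ∀ N {f g : ℕ → ℤ} → (∀ i → i ≤ N → f i ≡₂ g i) → Σ≤ N f ≡₂ Σ≤ N g
Σ-cong₂ zero    h = h 0 z≤n
Σ-cong₂ (suc N) h = ≡₂-+ (Σ-cong₂ N (λ i i≤N → h i (ℕP.m≤n⇒m≤1+n i≤N))) (h (suc N) ℕP.≤-refl)

sign : ℕ → ℤ
sign zero    = 1ℤ
sign (suc k) = - sign k

Σ-sign₂ : ∀ K (g : ℕ → ℤ) → Σ≤ K (λ k → sign k * g k) ≡₂ Σ≤ K g
Σ-sign₂ K g = Σ-cong₂ K (λ k _ → ≡₂-trans (≡₂-* (sign≡₂1 k) (≡₂-refl {g k})) (≡⇒≡₂ (ℤP.*-identityˡ (g k))))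
  where sign≡₂1 : ∀ k → sign k ≡₂ 1ℤ
        sign≡₂1 zero    = ≡₂-refl
        sign≡₂1 (suc k) = ≡₂-trans (≡₂-neg (sign k)) (sign≡₂1 k)

1≢x+x : ∀ x → 1ℤ ≢ x + x
1≢x+x (+ zero)    ()
1≢x+x (+ suc k)   e = ℕP.0≢1+n (trans (ℕP.suc-injective (ℤP.+-injective e)) (ℕP.+-suc k k))
1≢x+x -[1+ k ]    ()

1≢₂0 : ¬ (1ℤ ≡₂ 0ℤ)
1≢₂0 (k by e) = 1≢x+x k (trans e (ℤP.+-identityˡ (k + k)))

residue-unique : ∀ r s → r < 2 → s < 2 → + r ≡₂ + s → r ≡ s
residue-unique 0 0 _ _ _ = refl
residue-unique 1 1 _ _ _ = refl
residue-unique 0 1 _ _ 0≡₂1 = contradiction (≡₂-sym 0≡₂1) 1≢₂0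
residue-unique 1 0 _ _ 1≡₂0 = contradiction 1≡₂0 1≢₂0
residue-unique (suc (suc _)) _ (s≤s (s≤s ())) _ _
residue-unique _ (suc (suc _)) _ (s≤s (s≤s ())) _

%ℕ2-residue : ∀ a r → r < 2 → a ≡₂ + r → a %ℕ 2 ≡ r
%ℕ2-residue a r r<2 a≡₂r = residue-unique (a %ℕ 2) r (n%ℕd<d a 2) r<2
  (≡₂-trans (≡₂-sym (a ℤ./ℕ 2 by trans (a≡a%ℕn+[a/ℕn]*n a 2) (cong (λ t → + (a %ℕ 2) + t) (double (a ℤ./ℕ 2)))))
            a≡₂r)
  where double : ∀ q → q * + 2 ≡ q + q
        double = solve-∀

module ≗-Reasoning = SetoidReasoning (ℕ →-setoid ℤ)

infixl 6 _⊕_ _⊖_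
_⊕_ : Series → Series → Series
(f ⊕ g) N = f N + g N

_⊖_ : Series → Series → Series
(f ⊖ g) N = f N - g N

mono : ℕ → Series
mono a N = if does (N ℕ.≟ a) then 1ℤ else 0ℤ

if-yes : ∀ {P : Set} (d : Dec P) {x y : ℤ} → P → (if does d then x else y) ≡ x
if-yes (yes _) p = refl
if-yes (no ¬p) p = contradiction p ¬p

if-no : ∀ {P : Set} (d : Dec P) {x y : ℤ} → ¬ P → (if does d then x else y) ≡ y
if-no (yes p) ¬p = contradiction p ¬p
if-no (no _)  ¬p = refl

mono-≡ : ∀ {a N} → N ≡ a → mono a N ≡ 1ℤ
mono-≡ {a} {N} = if-yes (N ℕ.≟ a)

mono-≢ : ∀ {a N} → N ≢ a → mono a N ≡ 0ℤ
mono-≢ {a} {N} = if-no (N ℕ.≟ a)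

mono0 : mono 0 ≗ one
mono0 zero    = refl
mono0 (suc N) = refl

one-above : ∀ {N} → 1 ≤ N → one N ≡ 0ℤ
one-above {suc _} _ = refl

Σ-mono-below : ∀ N a (g : ℕ → ℤ) → N < a → Σ≤ N (λ i → mono a i * g i) ≡ 0ℤ
Σ-mono-below N a g N<a = Σ-zero N (λ i i≤N →
  cong (_* g i) (mono-≢ (λ i≡a → ℕP.<-irrefl i≡a (ℕP.≤-<-trans i≤N N<a))))

Σ-mono : ∀ N a (g : ℕ → ℤ) → a ≤ N → Σ≤ N (λ i → mono a i * g i) ≡ g a
Σ-mono zero .zero g z≤n = ℤP.*-identityˡ (g 0)
Σ-mono (suc N) a g a≤1+N with ℕP.m≤n⇒m<n∨m≡n a≤1+N
... | inj₁ a<1+N = trans (cong₂ _+_ (Σ-mono N a g (ℕP.≤-pred a<1+N))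
                                    (cong (_* g (suc N)) (mono-≢ (λ e → ℕP.<-irrefl (sym e) a<1+N))))
                         (ℤP.+-identityʳ (g a))
... | inj₂ refl  = trans (cong₂ _+_ (Σ-mono-below N (suc N) g ℕP.≤-refl)
                                    (trans (cong (_* g (suc N)) (mono-≡ {suc N} refl)) (ℤP.*-identityˡ (g (suc N)))))
                         (ℤP.+-identityˡ (g (suc N)))

infix 4 _≈₂_
_≈₂_ : Series → Series → Set
f ≈₂ g = ∀ N → f N ≡₂ g N

≗⇒≈₂ : ∀ {f g} → f ≗ g → f ≈₂ g
≗⇒≈₂ e N = ≡⇒≡₂ (e N)

≈₂-refl : ∀ {f} → f ≈₂ f
≈₂-refl N = ≡₂-refl

≈₂-sym : ∀ {f g} → f ≈₂ g → g ≈₂ f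
≈₂-sym e N = ≡₂-sym (e N)

≈₂-trans : ∀ {f g h} → f ≈₂ g → g ≈₂ h → f ≈₂ h
≈₂-trans e e' N = ≡₂-trans (e N) (e' N)

AgreeBelow : ℕ → Series → Series → Set
AgreeBelow K f g = ∀ N → N < K → f N ≡ g N

⊛-agree : ∀ {K f f' g g'} → AgreeBelow K f f' → AgreeBelow K g g' → AgreeBelow K (f ⊛ g) (f' ⊛ g')
⊛-agree af ag N N<K = Σ-cong N (λ i i≤N →
  cong₂ _*_ (af i (ℕP.≤-<-trans i≤N N<K)) (ag (N ∸ i) (ℕP.≤-<-trans (ℕP.m∸n≤m N i) N<K)))

⊛-cong : ∀ {f f' g g'} → f ≗ f' → g ≗ g' → f ⊛ g ≗ f' ⊛ g'
⊛-cong ef eg N = ⊛-agree (λ M _ → ef M) (λ M _ → eg M) N (ℕP.n<1+n N)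

⊛-congˡ : ∀ {f f'} g → f ≗ f' → f ⊛ g ≗ f' ⊛ g
⊛-congˡ g ef = ⊛-cong {g = g} ef (λ _ → refl)

⊛-congʳ : ∀ f {g g'} → g ≗ g' → f ⊛ g ≗ f ⊛ g'
⊛-congʳ f eg = ⊛-cong {f = f} (λ _ → refl) eg

⊛-cong₂ : ∀ {f f' g g'} → f ≈₂ f' → g ≈₂ g' → f ⊛ g ≈₂ f' ⊛ g'
⊛-cong₂ ef eg N = Σ-cong₂ N (λ i _ → ≡₂-* (ef i) (eg (N ∸ i)))

⊛-comm : ∀ f g → f ⊛ g ≗ g ⊛ f
⊛-comm f g N = begin
    Σ≤ N (λ i → f i * g (N ∸ i))               ≡⟨ Σ-reverse N _ ⟩
    Σ≤ N (λ i → f (N ∸ i) * g (N ∸ (N ∸ i)))   ≡⟨ Σ-cong N (λ i i≤N →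
        trans (cong (λ m → f (N ∸ i) * g m) (ℕP.m∸[m∸n]≡n i≤N)) (ℤP.*-comm (f (N ∸ i)) (g i))) ⟩
    Σ≤ N (λ i → g i * f (N ∸ i))               ∎
  where open ≡-Reasoning

⊛-assoc : ∀ f g h → (f ⊛ g) ⊛ h ≗ f ⊛ (g ⊛ h)
⊛-assoc f g h N = begin
    Σ≤ N (λ a → Σ≤ a (λ i → f i * g (a ∸ i)) * h (N ∸ a))
  ≡⟨ Σ-cong N (λ a _ → sym (Σ-*ʳ a (h (N ∸ a)) (λ i → f i * g (a ∸ i)))) ⟩
    Σ≤ N (λ a → Σ≤ a (λ i → f i * g (a ∸ i) * h (N ∸ a)))
  ≡⟨ Σ-triangle N (λ i a → f i * g (a ∸ i) * h (N ∸ a)) ⟩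
    Σ≤ N (λ i → Σ≤ (N ∸ i) (λ j → f i * g (i ℕ.+ j ∸ i) * h (N ∸ (i ℕ.+ j))))
  ≡⟨ Σ-cong N (λ i _ → Σ-cong (N ∸ i) (λ j _ →
        trans (cong₂ (λ m m' → f i * g m * h m') (ℕP.m+n∸m≡n i j) (sym (ℕP.∸-+-assoc N i j)))
              (ℤP.*-assoc (f i) (g j) (h (N ∸ i ∸ j))))) ⟩
    Σ≤ N (λ i → Σ≤ (N ∸ i) (λ j → f i * (g j * h (N ∸ i ∸ j))))
  ≡⟨ Σ-cong N (λ i _ → Σ-*ˡ (N ∸ i) (f i) _) ⟩
    Σ≤ N (λ i → f i * Σ≤ (N ∸ i) (λ j → g j * h (N ∸ i ∸ j))) ∎
  where open ≡-Reasoning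

⊕-⊛ : ∀ f g h → (f ⊕ g) ⊛ h ≗ (f ⊛ h) ⊕ (g ⊛ h)
⊕-⊛ f g h N = trans (Σ-cong N (λ i _ → ℤP.*-distribʳ-+ (h (N ∸ i)) (f i) (g i))) (Σ-+ N _ _)

⊖-⊛ : ∀ f g h → (f ⊖ g) ⊛ h ≗ (f ⊛ h) ⊖ (g ⊛ h)
⊖-⊛ f g h N = begin
    Σ≤ N (λ i → (f i - g i) * h (N ∸ i))
  ≡⟨ Σ-cong N (λ i _ → distrib (f i) (g i) (h (N ∸ i))) ⟩
    Σ≤ N (λ i → f i * h (N ∸ i) + - (g i * h (N ∸ i)))
  ≡⟨ Σ-+ N _ _ ⟩
    (f ⊛ h) N + Σ≤ N (λ i → - (g i * h (N ∸ i)))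
  ≡⟨ cong (_+_ ((f ⊛ h) N)) (Σ-neg N _) ⟩
    (f ⊛ h) N - (g ⊛ h) N ∎
  where open ≡-Reasoning
        distrib : ∀ a b c → (a - b) * c ≡ a * c + - (b * c)
        distrib = solve-∀

mono-⊛ : ∀ a g N → a ≤ N → (mono a ⊛ g) N ≡ g (N ∸ a)
mono-⊛ a g N = Σ-mono N a (λ i → g (N ∸ i))

mono-⊛-below : ∀ a g N → N < a → (mono a ⊛ g) N ≡ 0ℤ
mono-⊛-below a g N = Σ-mono-below N a (λ i → g (N ∸ i))

one-⊛ : ∀ g → one ⊛ g ≗ g
one-⊛ g N = trans (⊛-congˡ g (λ M → sym (mono0 M)) N) (mono-⊛ 0 g N z≤n)

⊛-one : ∀ g → g ⊛ one ≗ g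
⊛-one g N = trans (⊛-comm g one N) (one-⊛ g N)

mono-mono : ∀ a b → mono a ⊛ mono b ≗ mono (a ℕ.+ b)
mono-mono a b N with ℕP.<-≤-connex N a
... | inj₁ N<a = trans (mono-⊛-below a (mono b) N N<a)
                       (sym (mono-≢ (λ e → ℕP.<⇒≱ N<a (subst (a ≤_) (sym e) (ℕP.m≤m+n a b)))))
... | inj₂ a≤N = trans (mono-⊛ a (mono b) N a≤N) (shifted (N ∸ a ℕ.≟ b))
  where shifted : Dec (N ∸ a ≡ b) → mono b (N ∸ a) ≡ mono (a ℕ.+ b) N
        shifted (yes e) = trans (mono-≡ e) (sym (mono-≡ (trans (sym (ℕP.m+[n∸m]≡n a≤N)) (cong (a ℕ.+_) e))))
        shifted (no ¬e) = trans (mono-≢ ¬e) (sym (mono-≢ (λ e → ¬e (trans (cong (_∸ a) e) (ℕP.m+n∸m≡n a b)))))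

⊛-interchange : ∀ a b c d → (a ⊛ b) ⊛ (c ⊛ d) ≗ (a ⊛ c) ⊛ (b ⊛ d)
⊛-interchange a b c d = begin
    (a ⊛ b) ⊛ (c ⊛ d)  ≈⟨ ⊛-assoc a b (c ⊛ d) ⟩
    a ⊛ (b ⊛ (c ⊛ d))  ≈⟨ ⊛-congʳ a (⊛-assoc b c d) ⟨
    a ⊛ ((b ⊛ c) ⊛ d)  ≈⟨ ⊛-congʳ a (⊛-congˡ d (⊛-comm b c)) ⟩
    a ⊛ ((c ⊛ b) ⊛ d)  ≈⟨ ⊛-congʳ a (⊛-assoc c b d) ⟩
    a ⊛ (c ⊛ (b ⊛ d))  ≈⟨ ⊛-assoc a c (b ⊛ d) ⟨
    (a ⊛ c) ⊛ (b ⊛ d)  ∎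
  where open ≗-Reasoning

≈₂-setoid : Setoid _ _
≈₂-setoid = record
  { Carrier       = Series
  ; _≈_           = _≈₂_
  ; isEquivalence = record { refl = ≈₂-refl ; sym = ≈₂-sym ; trans = ≈₂-trans }
  }

module ≈₂-Reasoning = SetoidReasoning ≈₂-setoid

pow4-cong : ∀ {f g} → f ≗ g → pow4 f ≗ pow4 g
pow4-cong e = ⊛-cong e (⊛-cong e (⊛-cong e e))

pow4-⊛ : ∀ f g → pow4 f ⊛ pow4 g ≗ pow4 (f ⊛ g)
pow4-⊛ f g = begin
    (f ⊛ (f ⊛ (f ⊛ f))) ⊛ (g ⊛ (g ⊛ (g ⊛ g)))  ≈⟨ ⊛-interchange f (f ⊛ (f ⊛ f)) g (g ⊛ (g ⊛ g)) ⟩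
    (f ⊛ g) ⊛ ((f ⊛ (f ⊛ f)) ⊛ (g ⊛ (g ⊛ g)))  ≈⟨ ⊛-congʳ (f ⊛ g) (⊛-interchange f (f ⊛ f) g (g ⊛ g)) ⟩
    (f ⊛ g) ⊛ ((f ⊛ g) ⊛ ((f ⊛ f) ⊛ (g ⊛ g)))  ≈⟨ ⊛-congʳ (f ⊛ g) (⊛-congʳ (f ⊛ g) (⊛-interchange f f g g)) ⟩
    pow4 (f ⊛ g)                              ∎
  where open ≗-Reasoning

pow4-one : pow4 one ≗ one
pow4-one N = trans (one-⊛ (one ⊛ (one ⊛ one)) N) (trans (one-⊛ (one ⊛ one) N) (one-⊛ one N))

inverse-unique₂ : ∀ {a a' b c} → a ⊛ b ≗ one → a ≈₂ a' → a' ⊛ c ≗ one → b ≈₂ c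
inverse-unique₂ {a} {a'} {b} {c} ab≗1 a≈₂a' a'c≗1 = begin
    b               ≈⟨ ≗⇒≈₂ (⊛-one b) ⟨
    b ⊛ one         ≈⟨ ≗⇒≈₂ (⊛-congʳ b a'c≗1) ⟨
    b ⊛ (a' ⊛ c)    ≈⟨ ⊛-cong₂ (≈₂-refl {b}) (⊛-cong₂ (≈₂-sym a≈₂a') (≈₂-refl {c})) ⟩
    b ⊛ (a ⊛ c)     ≈⟨ ≗⇒≈₂ (⊛-assoc b a c) ⟨
    (b ⊛ a) ⊛ c     ≈⟨ ≗⇒≈₂ (⊛-congˡ c (λ N → trans (⊛-comm b a N) (ab≗1 N))) ⟩
    one ⊛ c         ≈⟨ ≗⇒≈₂ (one-⊛ c) ⟩
    c               ∎
  where open ≈₂-Reasoning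

oneMinusQ^-≗ : ∀ k → oneMinusQ^ (suc k) ≗ one ⊖ mono (suc k)
oneMinusQ^-≗ k zero    = refl
oneMinusQ^-≗ k (suc N) with does (suc N ℕ.≟ suc k)
... | true  = refl
... | false = refl

geom-∣ : ∀ k N → suc k ∣ N → geom k N ≡ 1ℤ
geom-∣ k N = if-yes (suc k ∣? N)

geom-∤ : ∀ k N → ¬ (suc k ∣ N) → geom k N ≡ 0ℤ
geom-∤ k N = if-no (suc k ∣? N)

geom-low : ∀ k → AgreeBelow (suc k) (geom k) one
geom-low k zero    _       = geom-∣ k 0 (suc k ∣0)
geom-low k (suc N) N<1+k   = geom-∤ k (suc N) (λ d → ℕP.<⇒≱ N<1+k (∣⇒≤ d))

geom-periodic : ∀ k N → suc k ≤ N → geom k N ≡ geom k (N ∸ suc k)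
geom-periodic k N n≤N with suc k ∣? N
... | yes d = trans (geom-∣ k N d) (sym (geom-∣ k (N ∸ suc k) (∣m+n∣m⇒∣n n∣n+[N∸n] ∣-refl)))
  where n∣n+[N∸n] : suc k ∣ suc k ℕ.+ (N ∸ suc k)
        n∣n+[N∸n] = subst (suc k ∣_) (sym (ℕP.m+[n∸m]≡n n≤N)) d
... | no ¬d = trans (geom-∤ k N ¬d) (sym (geom-∤ k (N ∸ suc k) (λ d → ¬d (∣m∸n∣n⇒∣m (suc k) n≤N d ∣-refl))))

geom-inverse : ∀ k → oneMinusQ^ (suc k) ⊛ geom k ≗ one
geom-inverse k N = begin
    (oneMinusQ^ n ⊛ geom k) N             ≡⟨ ⊛-congˡ (geom k) (oneMinusQ^-≗ k) N ⟩
    ((one ⊖ mono n) ⊛ geom k) N           ≡⟨ ⊖-⊛ one (mono n) (geom k) N ⟩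
    (one ⊛ geom k) N - (mono n ⊛ geom k) N ≡⟨ cong (_- (mono n ⊛ geom k) N) (one-⊛ (geom k) N) ⟩
    geom k N - (mono n ⊛ geom k) N        ≡⟨ byDegree (ℕP.<-≤-connex N n) ⟩
    one N                                 ∎
  where
  open ≡-Reasoning
  n = suc k
  byDegree : N < n ⊎ n ≤ N → geom k N - (mono n ⊛ geom k) N ≡ one N
  byDegree (inj₁ N<n) = begin
    geom k N - (mono n ⊛ geom k) N  ≡⟨ cong (_-_ (geom k N)) (mono-⊛-below n (geom k) N N<n) ⟩
    geom k N - 0ℤ                   ≡⟨ ℤP.+-identityʳ (geom k N) ⟩
    geom k N                        ≡⟨ geom-low k N N<n ⟩
    one N                           ∎
  byDegree (inj₂ n≤N) = begin
    geom k N - (mono n ⊛ geom k) N        ≡⟨ cong₂ _-_ (geom-periodic k N n≤N) (mono-⊛ n (geom k) N n≤N) ⟩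
    geom k (N ∸ n) - geom k (N ∸ n)       ≡⟨ ℤP.+-inverseʳ (geom k (N ∸ n)) ⟩
    0ℤ                                    ≡⟨ one-above (ℕP.≤-trans (s≤s z≤n) n≤N) ⟨
    one N                                 ∎

-- Modulo 2:  (1 - q^n)^4 ≡ (1 + q^n)^4 ≡ 1 + q^{4n} ≡ 1 - q^{4n}  (Frobenius).

oneMinusQ^≈₂ : ∀ k → oneMinusQ^ (suc k) ≈₂ one ⊕ mono (suc k)
oneMinusQ^≈₂ k N = ≡₂-trans (≡⇒≡₂ (oneMinusQ^-≗ k N)) (≡₂-+ (≡₂-refl {one N}) (≡₂-neg (mono (suc k) N)))

frobenius₂ : ∀ a → (one ⊕ mono a) ⊛ (one ⊕ mono a) ≈₂ one ⊕ mono (a ℕ.+ a)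
frobenius₂ a N = ≡₂-trans (≡⇒≡₂ expand) (mono a N by double (one N) (mono a N) (mono (a ℕ.+ a) N))
  where
  open ≡-Reasoning
  D = one ⊕ mono a
  expand : (D ⊛ D) N ≡ (one N + mono a N) + (mono a N + mono (a ℕ.+ a) N)
  expand = begin
      (D ⊛ D) N                             ≡⟨ ⊕-⊛ one (mono a) D N ⟩
      (one ⊛ D) N + (mono a ⊛ D) N          ≡⟨ cong₂ _+_ (one-⊛ D N) (⊛-comm (mono a) D N) ⟩
      D N + (D ⊛ mono a) N                  ≡⟨ cong (_+_ (D N)) (⊕-⊛ one (mono a) (mono a) N) ⟩
      D N + ((one ⊛ mono a) N + (mono a ⊛ mono a) N)
        ≡⟨ cong (_+_ (D N)) (cong₂ _+_ (one-⊛ (mono a) N) (mono-mono a a N)) ⟩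
      (one N + mono a N) + (mono a N + mono (a ℕ.+ a) N) ∎
  double : ∀ x y z → (x + y) + (y + z) ≡ x + z + (y + y)
  double = solve-∀

pow4-oneMinusQ^ : ∀ k → pow4 (oneMinusQ^ (suc k)) ≈₂ oneMinusQ^ (4 ℕ.* suc k)
pow4-oneMinusQ^ k = begin
    E ⊛ (E ⊛ (E ⊛ E))                        ≈⟨ ≗⇒≈₂ (⊛-assoc E E (E ⊛ E)) ⟨
    (E ⊛ E) ⊛ (E ⊛ E)                        ≈⟨ ⊛-cong₂ (⊛-cong₂ E≈D E≈D) (⊛-cong₂ E≈D E≈D) ⟩
    (D n ⊛ D n) ⊛ (D n ⊛ D n)                ≈⟨ ⊛-cong₂ (frobenius₂ n) (frobenius₂ n) ⟩
    D (n ℕ.+ n) ⊛ D (n ℕ.+ n)                ≈⟨ frobenius₂ (n ℕ.+ n) ⟩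
    D (n ℕ.+ n ℕ.+ (n ℕ.+ n))                ≈⟨ ≗⇒≈₂ (λ N → cong (λ m → D m N) (four n)) ⟩
    D (4 ℕ.* n)                              ≈⟨ oneMinusQ^≈₂ _ ⟨
    oneMinusQ^ (4 ℕ.* n)                     ∎
  where
  open ≈₂-Reasoning
  n = suc k
  E = oneMinusQ^ n
  D : ℕ → Series
  D a = one ⊕ mono a
  E≈D = oneMinusQ^≈₂ k
  four : ∀ n → n ℕ.+ n ℕ.+ (n ℕ.+ n) ≡ 4 ℕ.* n
  four = ℕSolver.solve-∀

geom-inverse4 : ∀ k → oneMinusQ^ (4 ℕ.* suc k) ⊛ geom (3 ℕ.+ 4 ℕ.* k) ≗ one
geom-inverse4 k = subst (λ n → oneMinusQ^ n ⊛ geom (3 ℕ.+ 4 ℕ.* k) ≗ one)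
                        (sym (ℕP.*-suc 4 k)) (geom-inverse (3 ℕ.+ 4 ℕ.* k))

pow4-geom : ∀ k → pow4 (geom k) ≈₂ geom (3 ℕ.+ 4 ℕ.* k)
pow4-geom k = inverse-unique₂ {a = pow4 (oneMinusQ^ (suc k))} product≗one (pow4-oneMinusQ^ k) (geom-inverse4 k)
  where product≗one : pow4 (oneMinusQ^ (suc k)) ⊛ pow4 (geom k) ≗ one
        product≗one N = trans (pow4-⊛ (oneMinusQ^ (suc k)) (geom k) N)
                              (trans (pow4-cong (geom-inverse k) N) (pow4-one N))

factor≈₂ : ∀ j → factor j ≈₂ oneMinusQ^ (28 ℕ.* suc j) ⊛ geom (3 ℕ.+ 4 ℕ.* j)
factor≈₂ j = ⊛-cong₂ (≈₂-trans (pow4-oneMinusQ^ _) (≗⇒≈₂ (λ N → cong (λ m → oneMinusQ^ m N) (seven j))))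
                     (pow4-geom j)
  where seven : ∀ j → 4 ℕ.* (7 ℕ.* suc j) ≡ 28 ℕ.* suc j
        seven = ℕSolver.solve-∀

∏< : ℕ → (ℕ → Series) → Series
∏< zero    F = one
∏< (suc M) F = ∏< M F ⊛ F M

∏-cong : ∀ M {F G : ℕ → Series} → (∀ j → F j ≗ G j) → ∏< M F ≗ ∏< M G
∏-cong zero    e = λ _ → refl
∏-cong (suc M) e = ⊛-cong (∏-cong M e) (e M)

∏-cong₂ : ∀ M {F G : ℕ → Series} → (∀ j → F j ≈₂ G j) → ∏< M F ≈₂ ∏< M G
∏-cong₂ zero    e = ≈₂-refl
∏-cong₂ (suc M) e = ⊛-cong₂ (∏-cong₂ M e) (e M)

∏-⊛ : ∀ M (F G : ℕ → Series) → ∏< M (λ j → F j ⊛ G j) ≗ ∏< M F ⊛ ∏< M G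
∏-⊛ zero    F G N = sym (one-⊛ one N)
∏-⊛ (suc M) F G = begin
    ∏< M (λ j → F j ⊛ G j) ⊛ (F M ⊛ G M)   ≈⟨ ⊛-congˡ (F M ⊛ G M) (∏-⊛ M F G) ⟩
    (∏< M F ⊛ ∏< M G) ⊛ (F M ⊛ G M)        ≈⟨ ⊛-interchange (∏< M F) (∏< M G) (F M) (G M) ⟩
    (∏< M F ⊛ F M) ⊛ (∏< M G ⊛ G M)        ∎
  where open ≗-Reasoning

∏-one : ∀ M {F : ℕ → Series} → (∀ j → F j ≗ one) → ∏< M F ≗ one
∏-one zero    e = λ _ → refl
∏-one (suc M) e N = trans (⊛-cong (∏-one M e) (e M) N) (one-⊛ one N)

∏-first : ∀ M (F : ℕ → Series) → ∏< (suc M) F ≗ F 0 ⊛ ∏< M (F ∘ suc)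
∏-first zero    F N = trans (one-⊛ (F 0) N) (sym (⊛-one (F 0) N))
∏-first (suc M) F = begin
    ∏< (suc M) F ⊛ F (suc M)                  ≈⟨ ⊛-congˡ (F (suc M)) (∏-first M F) ⟩
    (F 0 ⊛ ∏< M (F ∘ suc)) ⊛ F (suc M)        ≈⟨ ⊛-assoc (F 0) (∏< M (F ∘ suc)) (F (suc M)) ⟩
    F 0 ⊛ ∏< (suc M) (F ∘ suc)                ∎
  where open ≗-Reasoning

partialProd-∏ : ∀ M → partialProd M ≡ ∏< M factor
partialProd-∏ zero    = refl
partialProd-∏ (suc M) = cong (_⊛ factor M) (partialProd-∏ M)

qPoch : ℕ → ℕ → ℕ → Series
qPoch d k r = ∏< r (λ i → oneMinusQ^ (d ℕ.* (k ℕ.+ suc i)))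

qPoch-length : ∀ d k {r r'} → r ≡ r' → qPoch d k r ≗ qPoch d k r'
qPoch-length d k refl N = refl

qPoch-first : ∀ d j r → qPoch d j (suc r) ≗ oneMinusQ^ (d ℕ.* suc j) ⊛ qPoch d (suc j) r
qPoch-first d j r = begin
    qPoch d j (suc r)                                          ≈⟨ ∏-first r _ ⟩
    oneMinusQ^ (d ℕ.* (j ℕ.+ 1)) ⊛ ∏< r (λ i → oneMinusQ^ (d ℕ.* (j ℕ.+ suc (suc i))))
      ≈⟨ ⊛-cong (exponent (ℕP.+-comm j 1)) (∏-cong r (λ i → exponent (ℕP.+-suc j (suc i)))) ⟩
    oneMinusQ^ (d ℕ.* suc j) ⊛ qPoch d (suc j) r               ∎
  where open ≗-Reasoning
        exponent : ∀ {a b} → a ≡ b → oneMinusQ^ (d ℕ.* a) ≗ oneMinusQ^ (d ℕ.* b)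
        exponent refl N = refl

geomProd : ℕ → Series
geomProd M = ∏< M (λ j → geom (3 ℕ.+ 4 ℕ.* j))

geomProd-inverse : ∀ M → qPoch 4 0 M ⊛ geomProd M ≗ one
geomProd-inverse M N = trans (sym (∏-⊛ M _ _ N)) (∏-one M geom-inverse4 N)

partialProd≈₂ : ∀ M → partialProd M ≈₂ qPoch 28 0 M ⊛ geomProd M
partialProd≈₂ M rewrite partialProd-∏ M = ≈₂-trans (∏-cong₂ M factor≈₂) (≗⇒≈₂ (∏-⊛ M _ _))

mono-oneMinusQ^ : ∀ A b X → mono A ⊛ (oneMinusQ^ (suc b) ⊛ X) ≗ (mono A ⊛ X) ⊖ (mono (A ℕ.+ suc b) ⊛ X)
mono-oneMinusQ^ A b X = begin
    mono A ⊛ (oneMinusQ^ B ⊛ X)                 ≈⟨ ⊛-assoc (mono A) (oneMinusQ^ B) X ⟨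
    (mono A ⊛ oneMinusQ^ B) ⊛ X                 ≈⟨ ⊛-congˡ X (⊛-congʳ (mono A) (oneMinusQ^-≗ b)) ⟩
    (mono A ⊛ (one ⊖ mono B)) ⊛ X               ≈⟨ ⊛-congˡ X (⊛-comm (mono A) (one ⊖ mono B)) ⟩
    ((one ⊖ mono B) ⊛ mono A) ⊛ X               ≈⟨ ⊛-congˡ X (⊖-⊛ one (mono B) (mono A)) ⟩
    ((one ⊛ mono A) ⊖ (mono B ⊛ mono A)) ⊛ X    ≈⟨ ⊛-congˡ X (λ N → cong₂ _-_ (one-⊛ (mono A) N) (mono-mono B A N)) ⟩
    (mono A ⊖ mono (B ℕ.+ A)) ⊛ X               ≈⟨ ⊖-⊛ (mono A) (mono (B ℕ.+ A)) X ⟩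
    (mono A ⊛ X) ⊖ (mono (B ℕ.+ A) ⊛ X)         ≈⟨ (λ N → cong (λ a → (mono A ⊛ X) N - (mono a ⊛ X) N) (ℕP.+-comm B A)) ⟩
    (mono A ⊛ X) ⊖ (mono (A ℕ.+ B) ⊛ X)         ∎
  where open ≗-Reasoning
        B = suc b

shift-cong : ∀ {a b} X → a ≡ b → mono a ⊛ X ≗ mono b ⊛ X
shift-cong X refl N = refl

tri : ℕ → ℕ
tri zero    = 0
tri (suc k) = tri k ℕ.+ suc k

-- pent⁻ k = k(3k-1)/2, written as (k-1)k + T_k.
pent⁻ : ℕ → ℕ
pent⁻ zero    = 0
pent⁻ (suc m) = m ℕ.* suc m ℕ.+ tri (suc m)

-- pent⁺ k = k(3k+1)/2 = k² + T_k.
pent⁺ : ℕ → ℕ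
pent⁺ k = k ℕ.* k ℕ.+ tri k

signedPowers : (ℕ → ℕ) → ℕ → Series
signedPowers e n N = Σ≤ n (λ k → sign k * mono (e k) N)

-- Shanks' finite form of Euler's pentagonal number theorem in the base q^d (d ≥ 1):
--   S_n = Σ_{k ≤ n} (-1)^k q^{d(nk + T_k)} (q^{d(k+1)}; q^d)_{n-k}
-- satisfies  S_n + 1 = Σ_{k ≤ n} (-1)^k (q^{d k(3k-1)/2} + q^{d k(3k+1)/2}).
module Shanks (d-1 : ℕ) where

  d : ℕ
  d = suc d-1

  term : ℕ → ℕ → Series
  term n k N = sign k * (mono (d ℕ.* (n ℕ.* k ℕ.+ tri k)) ⊛ qPoch d k (n ∸ k)) N

  shanksSum : ℕ → Series
  shanksSum n N = Σ≤ n (λ k → term n k N)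

  -- Passing from n = m to n = m + 1, the k-th term splits as  lowered m k - remainder m (k + 1)
  -- and  lowered m k = term m k + remainder m k,  so the sum telescopes.
  lowered : ℕ → ℕ → Series
  lowered m k N = sign k * (mono (d ℕ.* (suc m ℕ.* k ℕ.+ tri k)) ⊛ qPoch d k (m ∸ k)) N

  remainder : ℕ → ℕ → Series
  remainder m zero    N = 0ℤ
  remainder m (suc j) N = sign j * (mono (d ℕ.* (m ℕ.* suc j ℕ.+ tri (suc j))) ⊛ qPoch d j (m ∸ j)) N

  -- (q^{d(k+1)}; q^d)_{m+1-k} = (q^{d(k+1)}; q^d)_{m-k} · (1 - q^{d(m+1)})
  peel : ∀ m k N → k ≤ m → term (suc m) k N ≡ lowered m k N - remainder m (suc k) N
  peel m k N k≤m = begin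
      sign k * (mono A ⊛ qPoch d k (suc m ∸ k)) N
    ≡⟨ cong (sign k *_) (⊛-congʳ (mono A) lastFactor N) ⟩
      sign k * (mono A ⊛ (oneMinusQ^ (d ℕ.* suc m) ⊛ Q)) N
    ≡⟨ cong (sign k *_) (mono-oneMinusQ^ A _ Q N) ⟩
      sign k * ((mono A ⊛ Q) N - (mono (A ℕ.+ d ℕ.* suc m) ⊛ Q) N)
    ≡⟨ cong (λ x → sign k * ((mono A ⊛ Q) N - x)) (shift-cong Q (exponent d-1 m k (tri k)) N) ⟩
      sign k * ((mono A ⊛ Q) N - (mono C ⊛ Q) N)
    ≡⟨ distrib (sign k) _ _ ⟩
      lowered m k N - remainder m (suc k) N ∎
    where
    open ≡-Reasoning
    A = d ℕ.* (suc m ℕ.* k ℕ.+ tri k)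
    C = d ℕ.* (m ℕ.* suc k ℕ.+ tri (suc k))
    Q = qPoch d k (m ∸ k)
    lastFactor : qPoch d k (suc m ∸ k) ≗ oneMinusQ^ (d ℕ.* suc m) ⊛ Q
    lastFactor N = begin
        qPoch d k (suc m ∸ k) N                           ≡⟨ qPoch-length d k (ℕP.+-∸-assoc 1 k≤m) N ⟩
        (Q ⊛ oneMinusQ^ (d ℕ.* (k ℕ.+ suc (m ∸ k)))) N    ≡⟨ ⊛-comm Q (oneMinusQ^ (d ℕ.* (k ℕ.+ suc (m ∸ k)))) N ⟩
        (oneMinusQ^ (d ℕ.* (k ℕ.+ suc (m ∸ k))) ⊛ Q) N    ≡⟨ cong (λ a → (oneMinusQ^ (d ℕ.* a) ⊛ Q) N) k+[1+m-k] ⟩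
        (oneMinusQ^ (d ℕ.* suc m) ⊛ Q) N                  ∎
      where k+[1+m-k] = trans (ℕP.+-suc k (m ∸ k)) (cong suc (ℕP.m+[n∸m]≡n k≤m))
    exponent : ∀ d-1 m k t → suc d-1 ℕ.* (suc m ℕ.* k ℕ.+ t) ℕ.+ suc d-1 ℕ.* suc m
                           ≡ suc d-1 ℕ.* (m ℕ.* suc k ℕ.+ (t ℕ.+ suc k))
    exponent = ℕSolver.solve-∀
    distrib : ∀ s a c → s * (a - c) ≡ s * a - s * c
    distrib = solve-∀

  -- for k ≥ 1, remainder m k contains (q^{dk}; q^d)_{m+1-k} = (1 - q^{dk}) · (q^{d(k+1)}; q^d)_{m-k}
  split : ∀ m k N → k ≤ m → lowered m k N ≡ term m k N + remainder m k N
  split m zero    N _   = sym (ℤP.+-identityʳ _)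
  split m (suc j) N j<m = begin
      - sign j * (mono (d ℕ.* (suc m ℕ.* suc j ℕ.+ tri (suc j))) ⊛ Q) N
    ≡⟨ cong (- sign j *_) (shift-cong Q (exponent d-1 m j (tri (suc j))) N) ⟩
      - sign j * (mono (C ℕ.+ d ℕ.* suc j) ⊛ Q) N
    ≡⟨ regroup (sign j) ((mono C ⊛ Q) N) ((mono (C ℕ.+ d ℕ.* suc j) ⊛ Q) N) ⟩
      - sign j * (mono C ⊛ Q) N + sign j * ((mono C ⊛ Q) N - (mono (C ℕ.+ d ℕ.* suc j) ⊛ Q) N)
    ≡⟨ cong (λ x → - sign j * (mono C ⊛ Q) N + sign j * x) (sym (mono-oneMinusQ^ C _ Q N)) ⟩
      - sign j * (mono C ⊛ Q) N + sign j * (mono C ⊛ (oneMinusQ^ (d ℕ.* suc j) ⊛ Q)) N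
    ≡⟨ cong (λ x → - sign j * (mono C ⊛ Q) N + sign j * x) (⊛-congʳ (mono C) firstFactor N) ⟩
      term m (suc j) N + remainder m (suc j) N ∎
    where
    open ≡-Reasoning
    C = d ℕ.* (m ℕ.* suc j ℕ.+ tri (suc j))
    Q = qPoch d (suc j) (m ∸ suc j)
    firstFactor : oneMinusQ^ (d ℕ.* suc j) ⊛ Q ≗ qPoch d j (m ∸ j)
    firstFactor N = sym (trans (qPoch-length d j (ℕP.+-∸-assoc 1 j<m) N) (qPoch-first d j (m ∸ suc j) N))
    exponent : ∀ d-1 m j t → suc d-1 ℕ.* (suc m ℕ.* suc j ℕ.+ t)
                           ≡ suc d-1 ℕ.* (m ℕ.* suc j ℕ.+ t) ℕ.+ suc d-1 ℕ.* suc j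
    exponent = ℕSolver.solve-∀
    regroup : ∀ s u x → - s * x ≡ - s * u + s * (u - x)
    regroup = solve-∀

  emptyProduct : ∀ a k m N → (mono a ⊛ qPoch d k (m ∸ m)) N ≡ mono a N
  emptyProduct a k m N = trans (⊛-congʳ (mono a) (qPoch-length d k (ℕP.n∸n≡0 m)) N) (⊛-one (mono a) N)

  step : ∀ m N → shanksSum (suc m) N ≡ shanksSum m N + sign (suc m) * mono (d ℕ.* pent⁻ (suc m)) N
                                                    + sign (suc m) * mono (d ℕ.* pent⁺ (suc m)) N
  step m N = begin
      Σ≤ m (λ k → term (suc m) k N) + term (suc m) (suc m) N
    ≡⟨ cong₂ _+_ (Σ-cong m (λ k k≤m → trans (peel m k N k≤m) (cong (_- remainder m (suc k) N) (split m k N k≤m))))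
                 (cong (sign (suc m) *_) (emptyProduct _ (suc m) m N)) ⟩
      Σ≤ m (λ k → term m k N + remainder m k N - remainder m (suc k) N) + sign (suc m) * b
    ≡⟨ cong (_+ sign (suc m) * b) telescoped ⟩
      S + (0ℤ - remainder m (suc m) N) + sign (suc m) * b
    ≡⟨ cong (λ r → S + (0ℤ - sign m * r) + sign (suc m) * b) (emptyProduct _ m m N) ⟩
      S + (0ℤ - sign m * a) + sign (suc m) * b
    ≡⟨ negate S (sign m) a (sign (suc m) * b) ⟩
      S + sign (suc m) * a + sign (suc m) * b ∎
    where
    open ≡-Reasoning
    S = shanksSum m N
    a = mono (d ℕ.* pent⁻ (suc m)) N
    b = mono (d ℕ.* pent⁺ (suc m)) N
    telescoped : Σ≤ m (λ k → term m k N + remainder m k N - remainder m (suc k) N)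
               ≡ S + (0ℤ - remainder m (suc m) N)
    telescoped = trans (Σ-cong m (λ k _ → ℤP.+-assoc (term m k N) _ _))
                       (trans (Σ-+ m _ _) (cong (_+_ S) (Σ-telescope m (λ k → remainder m k N))))
    negate : ∀ S s a t → S + (0ℤ - s * a) + t ≡ S + (- s) * a + t
    negate = solve-∀

  identity : ∀ n N → shanksSum n N + one N
                   ≡ signedPowers (λ k → d ℕ.* pent⁻ k) n N + signedPowers (λ k → d ℕ.* pent⁺ k) n N
  identity zero N = begin
      1ℤ * (mono (d ℕ.* 0) ⊛ one) N + one N
    ≡⟨ cong₂ (λ x y → 1ℤ * x + y) (⊛-one (mono (d ℕ.* 0)) N)
             (trans (sym (mono0 N)) (cong (λ a → mono a N) (sym (ℕP.*-zeroʳ d)))) ⟩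
      1ℤ * mono (d ℕ.* 0) N + mono (d ℕ.* 0) N
    ≡⟨ cong (_+_ (1ℤ * mono (d ℕ.* 0) N)) (sym (ℤP.*-identityˡ _)) ⟩
      1ℤ * mono (d ℕ.* 0) N + 1ℤ * mono (d ℕ.* 0) N ∎
    where open ≡-Reasoning
  identity (suc m) N = begin
      shanksSum (suc m) N + one N               ≡⟨ cong (_+ one N) (step m N) ⟩
      shanksSum m N + x + y + one N             ≡⟨ moveOne (shanksSum m N) x y (one N) ⟩
      (shanksSum m N + one N) + x + y           ≡⟨ cong (λ z → z + x + y) (identity m N) ⟩
      signedPowers⁻ m + signedPowers⁺ m + x + y ≡⟨ interchange (signedPowers⁻ m) (signedPowers⁺ m) x y ⟩
      (signedPowers⁻ m + x) + (signedPowers⁺ m + y) ∎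
    where
    open ≡-Reasoning
    x = sign (suc m) * mono (d ℕ.* pent⁻ (suc m)) N
    y = sign (suc m) * mono (d ℕ.* pent⁺ (suc m)) N
    signedPowers⁻ signedPowers⁺ : ℕ → ℤ
    signedPowers⁻ n = signedPowers (λ k → d ℕ.* pent⁻ k) n N
    signedPowers⁺ n = signedPowers (λ k → d ℕ.* pent⁺ k) n N
    moveOne : ∀ S x y o → S + x + y + o ≡ (S + o) + x + y
    moveOne = solve-∀
    interchange : ∀ a b x y → a + b + x + y ≡ (a + x) + (b + y)
    interchange = solve-∀

  -- Below degree n + 1 only the k = 0 term contributes, so S_n agrees with (q^d; q^d)_n there.
  shanksSum-low : ∀ n → AgreeBelow (suc n) (shanksSum n) (qPoch d 0 n)
  shanksSum-low n N (s≤s N≤n) = trans (Σ-first-only n (λ k → term n k N) higher) leading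
    where
    leading : term n 0 N ≡ qPoch d 0 n N
    leading = trans (ℤP.*-identityˡ _) (trans (shift-cong (qPoch d 0 n) (noShift d-1 n) N) (mono-⊛ 0 (qPoch d 0 n) N z≤n))
      where noShift : ∀ d-1 n → suc d-1 ℕ.* (n ℕ.* 0 ℕ.+ 0) ≡ 0
            noShift = ℕSolver.solve-∀
    higher : ∀ k → term n (suc k) N ≡ 0ℤ
    higher k = trans (cong (sign (suc k) *_) (mono-⊛-below _ (qPoch d (suc k) (n ∸ suc k)) N beyond))
                     (ℤP.*-zeroʳ (sign (suc k)))
      where
      e = n ℕ.* suc k ℕ.+ tri (suc k)
      beyond : N < d ℕ.* e
      beyond = ℕP.≤-trans (s≤s N≤n)
        (ℕP.≤-trans (subst (_≤ e) (ℕP.+-comm n 1) (ℕP.+-mono-≤ (ℕP.m≤m*n n (suc k)) (ℕP.≤-trans (s≤s z≤n) (ℕP.m≤n+m (suc k) (tri k)))))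
                    (ℕP.m≤n*m e d))

pent⁺≡pent⁻+ : ∀ l → pent⁺ l ≡ pent⁻ l ℕ.+ l
pent⁺≡pent⁻+ zero    = refl
pent⁺≡pent⁻+ (suc m) = expand m (tri (suc m))
  where expand : ∀ m t → suc m ℕ.* suc m ℕ.+ t ≡ m ℕ.* suc m ℕ.+ t ℕ.+ suc m
        expand = ℕSolver.solve-∀

pent⁻-suc : ∀ k → pent⁻ (suc k) ≡ pent⁺ k ℕ.+ (k ℕ.+ suc k)
pent⁻-suc k = expand k (tri k)
  where expand : ∀ k t → k ℕ.* suc k ℕ.+ (t ℕ.+ suc k) ≡ k ℕ.* k ℕ.+ t ℕ.+ (k ℕ.+ suc k)
        expand = ℕSolver.solve-∀

tri-double : ∀ l → 2 ℕ.* tri l ≡ l ℕ.* suc l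
tri-double zero    = refl
tri-double (suc l) = begin
    2 ℕ.* (tri l ℕ.+ suc l)           ≡⟨ ℕP.*-distribˡ-+ 2 (tri l) (suc l) ⟩
    2 ℕ.* tri l ℕ.+ 2 ℕ.* suc l       ≡⟨ cong (ℕ._+ 2 ℕ.* suc l) (tri-double l) ⟩
    l ℕ.* suc l ℕ.+ 2 ℕ.* suc l       ≡⟨ expand l ⟩
    suc l ℕ.* suc (suc l)             ∎
  where open ≡-Reasoning
        expand : ∀ l → l ℕ.* suc l ℕ.+ 2 ℕ.* suc l ≡ suc l ℕ.* suc (suc l)
        expand = ℕSolver.solve-∀

pent⁺-closed : ∀ l → 4 ℕ.* pent⁺ l ≡ 2 ℕ.* l ℕ.* (3 ℕ.* l ℕ.+ 1)
pent⁺-closed l = begin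
    4 ℕ.* (l ℕ.* l ℕ.+ tri l)                   ≡⟨ expand l (tri l) ⟩
    4 ℕ.* (l ℕ.* l) ℕ.+ 2 ℕ.* (2 ℕ.* tri l)     ≡⟨ cong (λ t → 4 ℕ.* (l ℕ.* l) ℕ.+ 2 ℕ.* t) (tri-double l) ⟩
    4 ℕ.* (l ℕ.* l) ℕ.+ 2 ℕ.* (l ℕ.* suc l)     ≡⟨ collect l ⟩
    2 ℕ.* l ℕ.* (3 ℕ.* l ℕ.+ 1)                 ∎
  where open ≡-Reasoning
        expand : ∀ l t → 4 ℕ.* (l ℕ.* l ℕ.+ t) ≡ 4 ℕ.* (l ℕ.* l) ℕ.+ 2 ℕ.* (2 ℕ.* t)
        expand = ℕSolver.solve-∀
        collect : ∀ l → 4 ℕ.* (l ℕ.* l) ℕ.+ 2 ℕ.* (l ℕ.* suc l) ≡ 2 ℕ.* l ℕ.* (3 ℕ.* l ℕ.+ 1)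
        collect = ℕSolver.solve-∀

pent⁺-ℤ : ∀ l → + 2 * + l * (+ 3 * + l + 1ℤ) ≡ + (4 ℕ.* pent⁺ l)
pent⁺-ℤ l = sym (begin
    + (4 ℕ.* pent⁺ l)                       ≡⟨ cong +_ (pent⁺-closed l) ⟩
    + (2 ℕ.* l ℕ.* (3 ℕ.* l ℕ.+ 1))         ≡⟨ ℤP.pos-* (2 ℕ.* l) _ ⟩
    + (2 ℕ.* l) * + (3 ℕ.* l ℕ.+ 1)         ≡⟨ cong₂ _*_ (ℤP.pos-* 2 l) (trans (ℤP.pos-+ (3 ℕ.* l) 1) (cong (_+ 1ℤ) (ℤP.pos-* 3 l))) ⟩
    + 2 * + l * (+ 3 * + l + 1ℤ)            ∎)
  where open ≡-Reasoning

pent⁻-ℤ : ∀ l → + 2 * + l * (+ 3 * + l - 1ℤ) ≡ + (4 ℕ.* pent⁻ l)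
pent⁻-ℤ l = begin
    + 2 * + l * (+ 3 * + l - 1ℤ)                ≡⟨ lower (+ l) ⟩
    + 2 * + l * (+ 3 * + l + 1ℤ) - + 4 * + l    ≡⟨ cong₂ _-_ (pent⁺-ℤ l) (sym (ℤP.pos-* 4 l)) ⟩
    + (4 ℕ.* pent⁺ l) - + (4 ℕ.* l)             ≡⟨ cong (λ p → + (4 ℕ.* p) - + (4 ℕ.* l)) (pent⁺≡pent⁻+ l) ⟩
    + (4 ℕ.* (pent⁻ l ℕ.+ l)) - + (4 ℕ.* l)     ≡⟨ cong (λ z → + z - + (4 ℕ.* l)) (ℕP.*-distribˡ-+ 4 (pent⁻ l) l) ⟩
    + (4 ℕ.* pent⁻ l ℕ.+ 4 ℕ.* l) - + (4 ℕ.* l) ≡⟨ cong (_- + (4 ℕ.* l)) (ℤP.pos-+ (4 ℕ.* pent⁻ l) (4 ℕ.* l)) ⟩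
    + (4 ℕ.* pent⁻ l) + + (4 ℕ.* l) - + (4 ℕ.* l) ≡⟨ cancel (+ (4 ℕ.* pent⁻ l)) (+ (4 ℕ.* l)) ⟩
    + (4 ℕ.* pent⁻ l)                           ∎
  where open ≡-Reasoning
        lower : ∀ x → + 2 * x * (+ 3 * x - 1ℤ) ≡ + 2 * x * (+ 3 * x + 1ℤ) - + 4 * x
        lower = solve-∀
        cancel : ∀ a b → a + b - b ≡ a
        cancel = solve-∀

pent⁻≤pent⁺ : ∀ k → pent⁻ k ≤ pent⁺ k
pent⁻≤pent⁺ k = subst (pent⁻ k ≤_) (sym (pent⁺≡pent⁻+ k)) (ℕP.m≤m+n (pent⁻ k) k)

pent⁻<pent⁺ : ∀ k → 1 ≤ k → pent⁻ k < pent⁺ k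
pent⁻<pent⁺ (suc k) _ = subst (pent⁻ (suc k) <_) (sym (pent⁺≡pent⁻+ (suc k))) (ℕP.m<m+n (pent⁻ (suc k)) (s≤s z≤n))

pent⁺<pent⁻-suc : ∀ k → pent⁺ k < pent⁻ (suc k)
pent⁺<pent⁻-suc k = subst (pent⁺ k <_) (sym (pent⁻-suc k))
                          (ℕP.m<m+n (pent⁺ k) (ℕP.<-≤-trans (s≤s z≤n) (ℕP.m≤n+m (suc k) k)))

pent⁻-increasing : ∀ k → pent⁻ k < pent⁻ (suc k)
pent⁻-increasing k = ℕP.≤-<-trans (pent⁻≤pent⁺ k) (pent⁺<pent⁻-suc k)

pent⁺-increasing : ∀ k → pent⁺ k < pent⁺ (suc k)
pent⁺-increasing k = ℕP.<-≤-trans (pent⁺<pent⁻-suc k) (pent⁻≤pent⁺ (suc k))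

pent⁻-≥ : ∀ l → l ≤ pent⁻ l
pent⁻-≥ zero    = z≤n
pent⁻-≥ (suc k) = ℕP.≤-trans (ℕP.m≤n+m (suc k) k)
                    (subst (k ℕ.+ suc k ≤_) (sym (pent⁻-suc k)) (ℕP.m≤n+m (k ℕ.+ suc k) (pent⁺ k)))

pent⁺-≥ : ∀ l → l ≤ pent⁺ l
pent⁺-≥ l = ℕP.≤-trans (pent⁻-≥ l) (pent⁻≤pent⁺ l)

module Increasing (f : ℕ → ℕ) (f-step : ∀ k → f k < f (suc k)) where

  monotone-< : ∀ a b → a < b → f a < f b
  monotone-< a (suc b) (s≤s a≤b) with ℕP.m≤n⇒m<n∨m≡n a≤b
  ... | inj₁ a<b  = ℕP.<-trans (monotone-< a b a<b) (f-step b)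
  ... | inj₂ refl = f-step a

  monotone-≤ : ∀ a b → a ≤ b → f a ≤ f b
  monotone-≤ a b a≤b with ℕP.m≤n⇒m<n∨m≡n a≤b
  ... | inj₁ a<b  = ℕP.<⇒≤ (monotone-< a b a<b)
  ... | inj₂ refl = ℕP.≤-refl

  injective : ∀ a b → f a ≡ f b → a ≡ b
  injective a b fa≡fb with ℕP.<-cmp a b
  ... | tri< a<b _ _ = contradiction fa≡fb (ℕP.<⇒≢ (monotone-< a b a<b))
  ... | tri≈ _ a≡b _ = a≡b
  ... | tri> _ _ b<a = contradiction (sym fa≡fb) (ℕP.<⇒≢ (monotone-< b a b<a))

pent⁻≢pent⁺ : ∀ l k → 1 ≤ l → pent⁻ l ≢ pent⁺ k
pent⁻≢pent⁺ l k 1≤l e with ℕP.<-≤-connex k l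
... | inj₁ k<l = ℕP.<-irrefl (sym e) (ℕP.<-≤-trans (pent⁺<pent⁻-suc k) (Increasing.monotone-≤ pent⁻ pent⁻-increasing (suc k) l k<l))
... | inj₂ l≤k = ℕP.<-irrefl e (ℕP.≤-<-trans (Increasing.monotone-≤ pent⁻ pent⁻-increasing l k l≤k) (pent⁻<pent⁺ k (ℕP.≤-trans 1≤l l≤k)))

pent⁺≢pent⁻ : ∀ l k → 1 ≤ l → pent⁺ l ≢ pent⁻ k
pent⁺≢pent⁻ (suc l) zero    _ e = ℕP.<-irrefl (sym e) (ℕP.<-≤-trans (s≤s z≤n) (pent⁺-≥ (suc l)))
pent⁺≢pent⁻ l       (suc k) _ e = pent⁻≢pent⁺ (suc k) l (s≤s z≤n) (sym e)

hits : (ℕ → ℕ) → ℕ → ℕ → ℤ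
hits f K N = Σ≤ K (λ k → mono (f k) N)

hits-none : ∀ f K N → (∀ k → k ≤ K → f k ≢ N) → hits f K N ≡ 0ℤ
hits-none f K N miss = Σ-zero K (λ k k≤K → mono-≢ (miss k k≤K ∘ sym))

hits-once : ∀ f K N l → (∀ a b → f a ≡ f b → a ≡ b) → f l ≡ N → l ≤ K → hits f K N ≡ 1ℤ
hits-once f K N l inj fl≡N l≤K =
  trans (Σ-cong K (λ k _ → trans (indicator k) (sym (ℤP.*-identityʳ (mono l k))))) (Σ-mono K l (λ _ → 1ℤ) l≤K)
  where
  indicator : ∀ k → mono (f k) N ≡ mono l k
  indicator k with k ℕ.≟ l
  ... | yes refl = trans (mono-≡ (sym fl≡N)) (sym (mono-≡ {k} refl))
  ... | no k≢l   = trans (mono-≢ (λ N≡fk → k≢l (inj k l (sym (trans fl≡N N≡fk))))) (sym (mono-≢ k≢l))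

Pentagonal : ℕ → ℕ → Set
Pentagonal d N = ∃[ l ] (N ≡ d ℕ.* pent⁻ l ⊎ N ≡ d ℕ.* pent⁺ l)

module Parity (d-1 : ℕ) where

  open Shanks d-1

  hits⁻ hits⁺ : ℕ → ℕ → ℤ
  hits⁻ = hits (λ k → d ℕ.* pent⁻ k)
  hits⁺ = hits (λ k → d ℕ.* pent⁺ k)

  shanks₂ : ∀ K N → shanksSum K N + one N ≡₂ hits⁻ K N + hits⁺ K N
  shanks₂ K N = ≡₂-trans (≡⇒≡₂ (identity K N)) (≡₂-+ (Σ-sign₂ K _) (Σ-sign₂ K _))

  injective⁻ : ∀ a b → d ℕ.* pent⁻ a ≡ d ℕ.* pent⁻ b → a ≡ b
  injective⁻ = Increasing.injective _ (λ k → ℕP.*-monoʳ-< d (pent⁻-increasing k))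

  injective⁺ : ∀ a b → d ℕ.* pent⁺ a ≡ d ℕ.* pent⁺ b → a ≡ b
  injective⁺ = Increasing.injective _ (λ k → ℕP.*-monoʳ-< d (pent⁺-increasing k))

  index≤ : ∀ {p : ℕ → ℕ} K l → l ≤ p l → d ℕ.* p l ≤ K → l ≤ K
  index≤ {p} K l l≤pl dpl≤K = ℕP.≤-trans l≤pl (ℕP.≤-trans (ℕP.m≤n*m (p l) d) dpl≤K)

  positive : ∀ {p : ℕ → ℕ} l → 1 ≤ p l → one (d ℕ.* p l) ≡ 0ℤ
  positive {p} l 1≤pl = one-above (ℕP.≤-trans 1≤pl (ℕP.m≤n*m (p l) d))

  -- A pentagonal multiple N ≤ K is hit twice if N = 0 and once otherwise, i.e. 1 + one N times.
  pentagonal-hits : ∀ K N → N ≤ K → Pentagonal d N → hits⁻ K N + hits⁺ K N ≡ 1ℤ + one N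
  pentagonal-hits K N N≤K (zero , inj₁ refl) rewrite ℕP.*-zeroʳ d =
    cong₂ _+_ (hits-once _ K 0 0 injective⁻ (ℕP.*-zeroʳ d) z≤n) (hits-once _ K 0 0 injective⁺ (ℕP.*-zeroʳ d) z≤n)
  pentagonal-hits K N N≤K (zero , inj₂ refl) rewrite ℕP.*-zeroʳ d =
    cong₂ _+_ (hits-once _ K 0 0 injective⁻ (ℕP.*-zeroʳ d) z≤n) (hits-once _ K 0 0 injective⁺ (ℕP.*-zeroʳ d) z≤n)
  pentagonal-hits K N N≤K (suc l , inj₁ refl) =
    cong₂ _+_ (hits-once _ K N (suc l) injective⁻ refl (index≤ {pent⁻} K (suc l) (pent⁻-≥ (suc l)) N≤K))
              (trans (hits-none _ K N (λ k _ e → pent⁻≢pent⁺ (suc l) k (s≤s z≤n) (ℕP.*-cancelˡ-≡ _ _ d (sym e))))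
                     (sym (positive {pent⁻} (suc l) (ℕP.≤-trans (s≤s z≤n) (pent⁻-≥ (suc l))))))
  pentagonal-hits K N N≤K (suc l , inj₂ refl) =
    trans (cong₂ _+_ (hits-none _ K N (λ k _ e → pent⁺≢pent⁻ (suc l) k (s≤s z≤n) (ℕP.*-cancelˡ-≡ _ _ d (sym e))))
                     (hits-once _ K N (suc l) injective⁺ refl (index≤ {pent⁺} K (suc l) (pent⁺-≥ (suc l)) N≤K)))
          (cong (_+_ 1ℤ) (sym (positive {pent⁺} (suc l) (ℕP.≤-trans (s≤s z≤n) (pent⁺-≥ (suc l))))))

  other-hits : ∀ K N → ¬ Pentagonal d N → hits⁻ K N + hits⁺ K N ≡ 0ℤ + one N
  other-hits K N ¬pent = cong₂ _+_
    (hits-none _ K N (λ k _ e → ¬pent (k , inj₁ (sym e))))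
    (trans (hits-none _ K N (λ k _ e → ¬pent (k , inj₂ (sym e)))) (sym (nonzero N (λ N≡0 → ¬pent (0 , inj₁ (trans N≡0 (sym (ℕP.*-zeroʳ d))))))))
    where nonzero : ∀ N → N ≢ 0 → one N ≡ 0ℤ
          nonzero zero    N≢0 = contradiction refl N≢0
          nonzero (suc N) _   = refl

  shanksSum-odd : ∀ K N → N ≤ K → Pentagonal d N → shanksSum K N ≡₂ 1ℤ
  shanksSum-odd K N N≤K pent = ≡₂-cancelʳ (one N) (≡₂-trans (shanks₂ K N) (≡⇒≡₂ (pentagonal-hits K N N≤K pent)))

  shanksSum-even : ∀ K N → ¬ Pentagonal d N → shanksSum K N ≡₂ 0ℤ
  shanksSum-even K N ¬pent = ≡₂-cancelʳ (one N) (≡₂-trans (shanks₂ K N) (≡⇒≡₂ (other-hits K N ¬pent)))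

bSeries : Series
bSeries N = b7⁺ (+ N)

AgreeBelow-≤ : ∀ {K K' f g} → K' ≤ K → AgreeBelow K f g → AgreeBelow K' f g
AgreeBelow-≤ K'≤K agree N N<K' = agree N (ℕP.<-≤-trans N<K' K'≤K)

⊛-low : ∀ {K f g} → AgreeBelow K f one → AgreeBelow K g one → AgreeBelow K (f ⊛ g) one
⊛-low f-low g-low N N<K = trans (⊛-agree f-low g-low N N<K) (one-⊛ one N)

oneMinusQ^-low : ∀ n → AgreeBelow n (oneMinusQ^ n) one
oneMinusQ^-low n zero    _     = refl
oneMinusQ^-low n (suc N) 1+N<n = if-no (suc N ℕ.≟ n) (λ e → ℕP.<-irrefl e 1+N<n)

-- The m-th factor is 1 below degree m, so the partial products stabilise.
factor-low : ∀ j → AgreeBelow (suc j) (factor j) one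
factor-low j = ⊛-low (pow4-low (AgreeBelow-≤ (ℕP.m≤n*m (suc j) 7) (oneMinusQ^-low (7 ℕ.* suc j))))
                     (pow4-low (geom-low j))
  where pow4-low : ∀ {K f} → AgreeBelow K f one → AgreeBelow K (pow4 f) one
        pow4-low f-low = ⊛-low f-low (⊛-low f-low (⊛-low f-low f-low))

partialProd-stable : ∀ M N → N ≤ M → partialProd M N ≡ prodCoeff N
partialProd-stable zero    .zero z≤n = refl
partialProd-stable (suc M) N N≤1+M with ℕP.m≤n⇒m<n∨m≡n N≤1+M
... | inj₂ refl  = refl
... | inj₁ N<1+M = begin
    (partialProd M ⊛ factor M) N   ≡⟨ ⊛-agree {f = partialProd M} (λ _ _ → refl) (factor-low M) N N<1+M ⟩
    (partialProd M ⊛ one) N        ≡⟨ ⊛-one (partialProd M) N ⟩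
    partialProd M N                ≡⟨ partialProd-stable M N (ℕP.≤-pred N<1+M) ⟩
    prodCoeff N                    ∎
  where open ≡-Reasoning

bSeries-low : ∀ n → AgreeBelow (suc n) bSeries (mono 1 ⊛ partialProd n)
bSeries-low n zero    _             = sym (mono-⊛-below 1 (partialProd n) 0 (s≤s z≤n))
bSeries-low n (suc M) (s≤s 1+M≤n)   = sym (trans (mono-⊛ 1 (partialProd n) (suc M) (s≤s z≤n))
                                                 (partialProd-stable n M (ℕP.≤-trans (ℕP.n≤1+n M) 1+M≤n)))

b7⁺-shift : ∀ n a → b7⁺ (+ n - + a) ≡ (mono a ⊛ bSeries) n
b7⁺-shift n a with ℕP.<-≤-connex n a
... | inj₁ n<a = trans (cong b7⁺ (trans (ℤP.[+m]-[+n]≡m⊖n n a) (trans (ℤP.⊖-< n<a) (negative (ℕP.m<n⇒0<n∸m n<a)))))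
                       (sym (mono-⊛-below a bSeries n n<a))
  where negative : ∀ {x} → 0 < x → - (+ x) ≡ -[1+ x ∸ 1 ]
        negative {suc x} _ = refl
... | inj₂ a≤n = trans (cong b7⁺ (trans (ℤP.[+m]-[+n]≡m⊖n n a) (ℤP.⊖-≥ a≤n))) (sym (mono-⊛ a bSeries n a≤n))

signedPowers-⊛ : ∀ e K g N → (signedPowers e K ⊛ g) N ≡ Σ≤ K (λ k → sign k * (mono (e k) ⊛ g) N)
signedPowers-⊛ e K g N = begin
    Σ≤ N (λ i → Σ≤ K (λ k → sign k * mono (e k) i) * g (N ∸ i))
  ≡⟨ Σ-cong N (λ i _ → trans (sym (Σ-*ʳ K (g (N ∸ i)) _)) (Σ-cong K (λ k _ → ℤP.*-assoc (sign k) _ _))) ⟩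
    Σ≤ N (λ i → Σ≤ K (λ k → sign k * (mono (e k) i * g (N ∸ i))))
  ≡⟨ Σ-swap N K _ ⟩
    Σ≤ K (λ k → Σ≤ N (λ i → sign k * (mono (e k) i * g (N ∸ i))))
  ≡⟨ Σ-cong K (λ k _ → Σ-*ˡ N (sign k) _) ⟩
    Σ≤ K (λ k → sign k * (mono (e k) ⊛ g) N) ∎
  where open ≡-Reasoning

module S₄ = Shanks 3
module S₂₈ = Shanks 27

lhs-shifts : ∀ n → lhs n ≡ Σ≤ n (λ k → (mono (4 ℕ.* pent⁻ k) ⊛ bSeries) n)
                         + Σ≤ n (λ k → (mono (4 ℕ.* pent⁺ (suc k)) ⊛ bSeries) n)
lhs-shifts n = cong₂ _+_
  (Σ-cong n (λ k _ → trans (cong (λ x → b7⁺ (+ n - x)) (pent⁻-ℤ k)) (b7⁺-shift n _)))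
  (Σ-cong n (λ k _ → trans (cong (λ x → b7⁺ (+ n - x)) (pent⁺-ℤ (suc k))) (b7⁺-shift n _)))

pent⁺-sum-shift : ∀ n → Σ≤ n (λ k → (mono (4 ℕ.* pent⁺ k) ⊛ bSeries) n)
                      ≡ bSeries n + Σ≤ n (λ k → (mono (4 ℕ.* pent⁺ (suc k)) ⊛ bSeries) n)
pent⁺-sum-shift n = begin
    Σ≤ n u                   ≡⟨ ℤP.+-identityʳ _ ⟨
    Σ≤ n u + 0ℤ              ≡⟨ cong (_+_ (Σ≤ n u)) (sym (mono-⊛-below _ bSeries n beyond)) ⟩
    Σ≤ (suc n) u             ≡⟨ Σ-first n u ⟩
    u 0 + Σ≤ n (u ∘ suc)     ≡⟨ cong (_+ Σ≤ n (u ∘ suc)) (mono-⊛ 0 bSeries n z≤n) ⟩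
    bSeries n + Σ≤ n (u ∘ suc) ∎
  where
  open ≡-Reasoning
  u : ℕ → ℤ
  u k = (mono (4 ℕ.* pent⁺ k) ⊛ bSeries) n
  beyond : n < 4 ℕ.* pent⁺ (suc n)
  beyond = ℕP.≤-trans (pent⁺-≥ (suc n)) (ℕP.m≤n*m (pent⁺ (suc n)) 4)

-- Step 1.  By Shanks' identity for q^4, the left-hand side is, modulo 2, the coefficient of q^n
-- in S₄ · B, where S₄ agrees with (q^4; q^4)_n up to degree n.
lhs≡₂ : ∀ n → lhs n ≡₂ (S₄.shanksSum n ⊛ bSeries) n
lhs≡₂ n = ≡₂-cancelʳ (bSeries n) (begin
    lhs n + B n                              ≡⟨ cong (_+ B n) (lhs-shifts n) ⟩
    Σ≤ n u⁻ + Σ≤ n (u⁺ ∘ suc) + B n          ≡⟨ moveB (Σ≤ n u⁻) _ (B n) ⟩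
    Σ≤ n u⁻ + (B n + Σ≤ n (u⁺ ∘ suc))        ≡⟨ cong (_+_ (Σ≤ n u⁻)) (sym (pent⁺-sum-shift n)) ⟩
    Σ≤ n u⁻ + Σ≤ n u⁺                        ≈⟨ ≡₂-+ (Σ-sign₂ n u⁻) (Σ-sign₂ n u⁺) ⟨
    Σ≤ n (λ k → sign k * u⁻ k) + Σ≤ n (λ k → sign k * u⁺ k)
      ≡⟨ cong₂ _+_ (signedPowers-⊛ _ n B n) (signedPowers-⊛ _ n B n) ⟨
    (Neg ⊛ B) n + (Pos ⊛ B) n                ≡⟨ ⊕-⊛ Neg Pos B n ⟨
    ((Neg ⊕ Pos) ⊛ B) n
      ≡⟨ ⊛-congˡ B (S₄.identity n) n ⟨
    ((S₄.shanksSum n ⊕ one) ⊛ B) n           ≡⟨ ⊕-⊛ (S₄.shanksSum n) one B n ⟩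
    (S₄.shanksSum n ⊛ B) n + (one ⊛ B) n     ≡⟨ cong (_+_ ((S₄.shanksSum n ⊛ B) n)) (one-⊛ B n) ⟩
    (S₄.shanksSum n ⊛ B) n + B n             ∎)
  where
  open ≡₂-Reasoning
  B = bSeries
  Neg = signedPowers (λ k → 4 ℕ.* pent⁻ k) n
  Pos = signedPowers (λ k → 4 ℕ.* pent⁺ k) n
  u⁻ u⁺ : ℕ → ℤ
  u⁻ k = (mono (4 ℕ.* pent⁻ k) ⊛ B) n
  u⁺ k = (mono (4 ℕ.* pent⁺ k) ⊛ B) n
  moveB : ∀ a b c → a + b + c ≡ a + (c + b)
  moveB = solve-∀

⊛-cancel : ∀ P x Q G → P ⊛ G ≗ one → P ⊛ (x ⊛ (Q ⊛ G)) ≗ x ⊛ Q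
⊛-cancel P x Q G PG≗1 = begin
    P ⊛ (x ⊛ (Q ⊛ G))    ≈⟨ ⊛-comm P (x ⊛ (Q ⊛ G)) ⟩
    (x ⊛ (Q ⊛ G)) ⊛ P    ≈⟨ ⊛-assoc x (Q ⊛ G) P ⟩
    x ⊛ ((Q ⊛ G) ⊛ P)    ≈⟨ ⊛-congʳ x (⊛-assoc Q G P) ⟩
    x ⊛ (Q ⊛ (G ⊛ P))    ≈⟨ ⊛-congʳ x (⊛-congʳ Q (λ N → trans (⊛-comm G P N) (PG≗1 N))) ⟩
    x ⊛ (Q ⊛ one)        ≈⟨ ⊛-congʳ x (⊛-one Q) ⟩
    x ⊛ Q                ∎
  where open ≗-Reasoning

-- Step 2.  Modulo 2,  B ≡ q (q^28; q^28)_n / (q^4; q^4)_n  up to degree n, so the factor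
-- (q^4; q^4)_n cancels and the coefficient becomes that of q^{n-1} in (q^28; q^28)_n,
-- i.e. in the Shanks sum for q^28.
convolution≡₂ : ∀ n' → (S₄.shanksSum (suc n') ⊛ bSeries) (suc n') ≡₂ S₂₈.shanksSum (suc n') n'
convolution≡₂ n' = begin
    (S₄.shanksSum n ⊛ bSeries) n
      ≡⟨ ⊛-agree (S₄.shanksSum-low n) (bSeries-low n) n ℕP.≤-refl ⟩
    (qPoch 4 0 n ⊛ (mono 1 ⊛ partialProd n)) n
      ≈⟨ ⊛-cong₂ (≈₂-refl {qPoch 4 0 n}) (⊛-cong₂ (≈₂-refl {mono 1}) (partialProd≈₂ n)) n ⟩
    (qPoch 4 0 n ⊛ (mono 1 ⊛ (qPoch 28 0 n ⊛ geomProd n))) n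
      ≡⟨ ⊛-cancel (qPoch 4 0 n) (mono 1) (qPoch 28 0 n) (geomProd n) (geomProd-inverse n) n ⟩
    (mono 1 ⊛ qPoch 28 0 n) n
      ≡⟨ mono-⊛ 1 (qPoch 28 0 n) n (s≤s z≤n) ⟩
    qPoch 28 0 n n'
      ≡⟨ S₂₈.shanksSum-low n n' (ℕP.n≤1+n n) ⟨
    S₂₈.shanksSum n n' ∎
  where open ≡₂-Reasoning
        n = suc n'

special-form : ∀ (l : ℕ) (x : ℤ) (y : ℕ) → + 2 * + l * x ≡ + (4 ℕ.* y) → + 14 * + l * x + 1ℤ ≡ + suc (28 ℕ.* y)
special-form l x y e = begin
    + 14 * + l * x + 1ℤ           ≡⟨ cong (_+ 1ℤ) (factor7 (+ l) x) ⟩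
    + 7 * (+ 2 * + l * x) + 1ℤ    ≡⟨ cong (λ z → + 7 * z + 1ℤ) e ⟩
    + 7 * + (4 ℕ.* y) + 1ℤ        ≡⟨ cong (_+ 1ℤ) (sym (ℤP.pos-* 7 (4 ℕ.* y))) ⟩
    + (7 ℕ.* (4 ℕ.* y)) + 1ℤ      ≡⟨ cong (λ z → + z + 1ℤ) (twentyEight y) ⟩
    + (28 ℕ.* y) + 1ℤ             ≡⟨ cong +_ (ℕP.+-comm (28 ℕ.* y) 1) ⟩
    + suc (28 ℕ.* y)              ∎
  where open ≡-Reasoning
        factor7 : ∀ a x → + 14 * a * x ≡ + 7 * (+ 2 * a * x)
        factor7 = solve-∀
        twentyEight : ∀ y → 7 ℕ.* (4 ℕ.* y) ≡ 28 ℕ.* y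
        twentyEight = ℕSolver.solve-∀

special⇒pentagonal : ∀ n' → SpecialForm (suc n') → Pentagonal 28 n'
special⇒pentagonal n' (l , inj₁ e) = l , inj₁ (ℕP.suc-injective (ℤP.+-injective (trans e (special-form l _ (pent⁻ l) (pent⁻-ℤ l)))))
special⇒pentagonal n' (l , inj₂ e) = l , inj₂ (ℕP.suc-injective (ℤP.+-injective (trans e (special-form l _ (pent⁺ l) (pent⁺-ℤ l)))))

pentagonal⇒special : ∀ n' → Pentagonal 28 n' → SpecialForm (suc n')
pentagonal⇒special n' (l , inj₁ e) = l , inj₁ (trans (cong (+_ ∘ suc) e) (sym (special-form l _ (pent⁻ l) (pent⁻-ℤ l))))
pentagonal⇒special n' (l , inj₂ e) = l , inj₂ (trans (cong (+_ ∘ suc) e) (sym (special-form l _ (pent⁺ l) (pent⁺-ℤ l))))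

lemma4p4 : (n : ℕ) → n ≥ 1 →
    (SpecialForm n → lhs n %ℕ 2 ≡ 1) × (¬ SpecialForm n → lhs n %ℕ 2 ≡ 0)
lemma4p4 (suc n') _ =
    (λ special → %ℕ2-residue (lhs n) 1 (s≤s (s≤s z≤n))
                   (≡₂-trans lhs≡₂S₂₈ (Parity.shanksSum-odd 27 n n' (ℕP.n≤1+n n') (special⇒pentagonal n' special))))
  , (λ ¬special → %ℕ2-residue (lhs n) 0 (s≤s z≤n)
                   (≡₂-trans lhs≡₂S₂₈ (Parity.shanksSum-even 27 n n' (¬special ∘ pentagonal⇒special n'))))
  where
  n = suc n'
  lhs≡₂S₂₈ : lhs n ≡₂ S₂₈.shanksSum n n'
  lhs≡₂S₂₈ = ≡₂-trans (lhs≡₂ n) (convolution≡₂ n')
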